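{- Let $t\ge 2$ and let $G$ be a simple graph on $n$ vertices. The $t$-clique tensor $\mathcal{A}(G)$ of $G$ is weakly irreducible if and only if $G$ is $t$-clique connected.
   Context: A $t$-clique is a set of $t$ vertices inducing a complete subgraph; $C_t(G)$ is the set of $t$-cliques. The $t$-clique tensor of $G$ is the order-$t$ dimension-$n$ tensor $\mathcal{A}(G)=(a_{i_1\cdots i_t})$ with $a_{i_1\cdots i_t}=\frac{1}{(t-1)!}$ if $\{i_1,\dots,i_t\}\in C_t(G)$ and $0$ otherwise. For a nonnegative order-$m$ dimension-$n$ tensor $\mathcal{A}=(a_{i_1\cdots i_m})$, its digraph $G_{\mathcal{A}}$ has vertex set $\{1,\dots,n\}$ and arc set $\{(i,j): a_{ii_2\cdots i_m}\ne 0 \text{ for some } i_2,\dots,i_m \text{ with } j\in\{i_2,\dots,i_m\}\}$; $\mathcal{A}$ is weakly irreducible if $G_{\mathcal{A}}$ is strongly connected. A $t$-clique walk is a sequence of $t$-cliques $c^1,\dots,c^m$ such that $c^i$ and $c^{i+1}$ share at least one vertex for each $i$; $G$ is $t$-clique connected if any two of its vertices are joined by a $t$-clique walk (i.e. one lies in the first clique and the other in the last). -}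

module Defs where

open import Level using (0ℓ)
open import Data.Nat using (ℕ; zero; suc; _∸_; _!)
open import Data.Nat.Properties using (_!≢0)
open import Data.Fin using (Fin)
open import Data.Fin.Properties using (all?)
open import Data.Integer using (+_)
open import Data.Rational using (ℚ; 0ℚ; _/_)
open import Data.Product using (Σ; ∃; _×_; _,_)
open import Data.Vec.Functional using (_∷_)
open import Relation.Binary.PropositionalEquality using (_≡_; _≢_)
open import Relation.Binary.Construct.Closure.ReflexiveTransitive using (Star)
open import Relation.Nullary using (Dec; ¬_; yes; no)
open import Relation.Nullary.Decidable using (_→-dec_; ¬?)
open import Data.Fin using (_≟_)

record SimpleGraph (n : ℕ) : Set₁ where
  field
    Adj   : Fin n → Fin n → Set
    sym   : ∀ {u v} → Adj u v → Adj v u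
    irrefl : ∀ {u} → ¬ Adj u u
    adj?  : ∀ u v → Dec (Adj u v)
open SimpleGraph public

-- A t-tuple of vertices whose underlying set {f 0, ..., f (t-1)} is a t-clique:
-- entries pairwise adjacent (hence pairwise distinct, by irreflexivity).
IsClique : ∀ {n} (G : SimpleGraph n) (t : ℕ) → (Fin t → Fin n) → Set
IsClique G t f = ∀ j k → j ≢ k → Adj G (f j) (f k)

isClique? : ∀ {n} (G : SimpleGraph n) (t : ℕ) (f : Fin t → Fin n) → Dec (IsClique G t f)
isClique? G t f = all? λ j → all? λ k → ¬? (j ≟ k) →-dec adj? G (f j) (f k)

Clique : ∀ {n} (G : SimpleGraph n) (t : ℕ) → Set
Clique {n} G t = Σ (Fin t → Fin n) (IsClique G t)

_∈C_ : ∀ {n} {G : SimpleGraph n} {t} → Fin n → Clique G t → Set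
v ∈C (f , _) = ∃ λ k → f k ≡ v

Share : ∀ {n} (G : SimpleGraph n) (t : ℕ) → Clique G t → Clique G t → Set
Share {n} G t c d = ∃ λ (v : Fin n) → (_∈C_ {G = G} v c) × (_∈C_ {G = G} v d)

data WalkTo {n} (G : SimpleGraph n) (t : ℕ) (v : Fin n) : Clique G t → Set where
  last : ∀ {c} → _∈C_ {G = G} v c → WalkTo G t v c
  step : ∀ {c d} → Share G t c d → WalkTo G t v d → WalkTo G t v c

Joined : ∀ {n} (G : SimpleGraph n) (t : ℕ) → Fin n → Fin n → Set
Joined G t u v = ∃ λ (c : Clique G t) → (_∈C_ {G = G} u c) × WalkTo G t v c

CliqueConnected : ∀ {n} (G : SimpleGraph n) (t : ℕ) → Set
CliqueConnected {n} G t = ∀ (u v : Fin n) → u ≢ v → Joined G t u v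

Tensor : ℕ → ℕ → Set
Tensor m n = (Fin m → Fin n) → ℚ

cliqueTensor : ∀ {n} (G : SimpleGraph n) (t : ℕ) → Tensor t n
cliqueTensor G t f with isClique? G t f
... | yes _ = + 1 / ((t ∸ 1) !) where instance _ = (t ∸ 1) !≢0
... | no _  = 0ℚ

Arc : ∀ {m n} → Tensor (suc m) n → Fin n → Fin n → Set
Arc {m} {n} A i j = ∃ λ (g : Fin m → Fin n) → (A (i ∷ g) ≢ 0ℚ) × (∃ λ k → g k ≡ j)

StronglyConnected : ∀ {n} → (Fin n → Fin n → Set) → Set
StronglyConnected {n} R = ∀ (i j : Fin n) → Star R i j

WeaklyIrreducible : ∀ {m n} → Tensor (suc m) n → Set
WeaklyIrreducible A = StronglyConnected (Arc A)

-- A nonzero entry a_{i i₂ ⋯ i_t} of the clique tensor is exactly a t-clique {i, i₂, …, i_t},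
-- so the arcs of the digraph of 𝒜(G) join precisely the distinct vertices lying in a common
-- t-clique. A directed path is therefore a chain of t-cliques, consecutive ones sharing the
-- vertex at which the path passes from one to the next, and conversely a t-clique walk
-- yields a directed path by moving inside each clique and crossing at a shared vertex.
module Submission where

open import Defs hiding (sym)
open import Data.Nat as ℕ using (ℕ; suc; _+_; _∸_; _!)
open import Data.Nat.Properties using (_!≢0)
open import Data.Integer using (+_)
open import Data.Rational using (0ℚ; _/_; Positive)
open import Data.Rational.Properties using (normalize-pos)
open import Data.Fin using (Fin; zero; suc; punchIn; punchOut; _≟_)
open import Data.Fin.Properties using (punchInᵢ≢i; punchIn-injective; punchIn-punchOut)
open import Data.Vec.Functional using (_∷_)
open import Data.Vec.Functional.Properties using (∷-cong)
open import Data.Product using (∃; _×_; _,_)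
open import Data.Empty using (⊥-elim)
open import Function using (_∘_)
open import Function.Bundles using (_⇔_; mk⇔)
open import Function.Definitions using (Injective)
open import Relation.Nullary using (yes; no)
open import Relation.Binary.PropositionalEquality
  using (_≡_; _≢_; _≗_; refl; sym; cong; subst; subst₂)
open import Relation.Binary.Construct.Closure.ReflexiveTransitive
  using (Star; ε; _◅_; _◅◅_)

1/n≢0 : ∀ n .{{_ : ℕ.NonZero n}} → + 1 / n ≢ 0ℚ
1/n≢0 n 1/n≡0 with subst Positive 1/n≡0 (normalize-pos 1 n)
... | ()

∷-punchIn-injective : ∀ {m} (i : Fin (suc m)) → Injective _≡_ _≡_ (i ∷ punchIn i)
∷-punchIn-injective i {zero}  {zero}  _  = refl
∷-punchIn-injective i {zero}  {suc k} eq = ⊥-elim (punchInᵢ≢i i k (sym eq))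
∷-punchIn-injective i {suc j} {zero}  eq = ⊥-elim (punchInᵢ≢i i j eq)
∷-punchIn-injective i {suc j} {suc k} eq = cong suc (punchIn-injective i j k eq)

module _ {n} (G : SimpleGraph n) where

  isClique-resp-≗ : ∀ {t} {f g : Fin t → Fin n} → f ≗ g → IsClique G t f → IsClique G t g
  isClique-resp-≗ f≗g f-clique j k j≢k = subst₂ (Adj G) (f≗g j) (f≗g k) (f-clique j k j≢k)

  isClique-∘-injective : ∀ {s t} {f : Fin t → Fin n} {τ : Fin s → Fin t} →
                         IsClique G t f → Injective _≡_ _≡_ τ → IsClique G s (f ∘ τ)
  isClique-∘-injective f-clique τ-injective j k j≢k = f-clique _ _ (j≢k ∘ τ-injective)

  isClique⇒cliqueTensor≢0 : ∀ {t} {f} → IsClique G t f → cliqueTensor G t f ≢ 0ℚ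
  isClique⇒cliqueTensor≢0 {t} {f} f-clique with isClique? G t f
  ... | yes _        = 1/n≢0 ((t ∸ 1) !) {{(t ∸ 1) !≢0}}
  ... | no ¬f-clique = λ _ → ¬f-clique f-clique

  cliqueTensor≢0⇒isClique : ∀ {t} {f} → cliqueTensor G t f ≢ 0ℚ → IsClique G t f
  cliqueTensor≢0⇒isClique {t} {f} entry≢0 with isClique? G t f
  ... | yes f-clique = f-clique
  ... | no _         = ⊥-elim (entry≢0 refl)

  module _ {m : ℕ} where

    private
      A : Tensor (suc m) n
      A = cliqueTensor G (suc m)

      _∈_ : Fin n → Clique G (suc m) → Set
      _∈_ = _∈C_ {G = G}

    -- The witness lists the clique f starting at f a: it is f ∘ (a ∷ punchIn a).
    clique⇒arc : ∀ (c : Clique G (suc m)) {x y} → x ∈ c → y ∈ c → x ≢ y → Arc A x y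
    clique⇒arc (f , f-clique) (a , refl) (b , refl) fa≢fb =
      f ∘ punchIn a , entry≢0 , punchOut a≢b , cong f (punchIn-punchOut a≢b)
      where
      a≢b : a ≢ b
      a≢b = fa≢fb ∘ cong f

      entry≢0 : A (f a ∷ f ∘ punchIn a) ≢ 0ℚ
      entry≢0 = isClique⇒cliqueTensor≢0
        (isClique-resp-≗ (∷-cong refl λ _ → refl)
          (isClique-∘-injective f-clique (∷-punchIn-injective a)))

    arc⇒clique : ∀ {x y} → Arc A x y → ∃ λ c → x ∈ c × y ∈ c
    arc⇒clique {x} (g , entry≢0 , k , gk≡y) =
      (x ∷ g , cliqueTensor≢0⇒isClique entry≢0) , (zero , refl) , (suc k , gk≡y)

    clique⇒path : ∀ (c : Clique G (suc m)) {x y} → x ∈ c → y ∈ c → Star (Arc A) x y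
    clique⇒path c {x} {y} x∈c y∈c with x ≟ y
    ... | yes refl = ε
    ... | no x≢y   = clique⇒arc c x∈c y∈c x≢y ◅ ε

    walkTo⇒path : ∀ {c x v} → x ∈ c → WalkTo G (suc m) v c → Star (Arc A) x v
    walkTo⇒path {c} x∈c (last v∈c)                     = clique⇒path c x∈c v∈c
    walkTo⇒path {c} x∈c (step (w , w∈c , w∈d) walk) = clique⇒path c x∈c w∈c ◅◅ walkTo⇒path w∈d walk

    arc◅path⇒joined : ∀ {x y v} → Arc A x y → Star (Arc A) y v → Joined G (suc m) x v
    arc◅path⇒joined arc ε with arc⇒clique arc
    ... | c , x∈c , y∈c = c , x∈c , last y∈c
    arc◅path⇒joined {y = y} arc (arc′ ◅ path) with arc⇒clique arc | arc◅path⇒joined arc′ path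
    ... | c , x∈c , y∈c | d , y∈d , walk = c , x∈c , step (y , y∈c , y∈d) walk

lemma3p1 : (n s : ℕ) (G : SimpleGraph n) →
           WeaklyIrreducible (cliqueTensor G (2 + s)) ⇔ CliqueConnected G (2 + s)
lemma3p1 n s G = mk⇔ irreducible⇒connected connected⇒irreducible
  where
  irreducible⇒connected : WeaklyIrreducible (cliqueTensor G (2 + s)) → CliqueConnected G (2 + s)
  irreducible⇒connected strong u v u≢v with strong u v
  ... | ε          = ⊥-elim (u≢v refl)
  ... | arc ◅ path = arc◅path⇒joined G arc path

  connected⇒irreducible : CliqueConnected G (2 + s) → WeaklyIrreducible (cliqueTensor G (2 + s))
  connected⇒irreducible connected u v with u ≟ v
  ... | yes refl = ε
  ... | no u≢v with connected u v u≢v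
  ...   | c , u∈c , walk = walkTo⇒path G u∈c walk
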